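{- Let $\mathcal{K}$ be a class of contexts. Then the sequent $\top\sqcap\top\dashv\vdash\bot\sqcup\bot$ (i.e. both sequents $\top\sqcap\top\vdash\bot\sqcup\bot$ and $\bot\sqcup\bot\vdash\top\sqcap\top$) is valid in $\mathcal{K}$ if and only if every context $(G,M,R)$ in $\mathcal{K}$ satisfies $R=G\times M$.
   Context: Formulae of PDBL are built from object variables $\mathbf{OV}$, property variables $\mathbf{PV}$ (disjoint countably infinite sets), constants $\top,\bot$, binary connectives $\sqcap,\sqcup$ and unary connectives $\neg,\lrcorner$. A context is $\mathbb{K}=(G,M,R)$ with sets $G,M$ and $R\subseteq G\times M$. For $A\subseteq G$, $A'=\{m\in M:gRm\ \forall g\in A\}$; for $B\subseteq M$, $B'=\{g\in G:gRm\ \forall m\in B\}$. A semiconcept is a pair $(A,B)$ with $A'=B$ or $B'=A$; $\mathfrak{H}(\mathbb{K})$ is the set of semiconcepts, $ext(A,B)=A$, $int(A,B)=B$, with $(A_1,B_1)\sqcap(A_2,B_2)=(A_1\cap A_2,(A_1\cap A_2)')$ and $(A_1,B_1)\sqcup(A_2,B_2)=((B_1\cap B_2)',B_1\cap B_2)$. A model is $\mathbb{M}=(\mathbb{K},v)$ with $v$ a map on $\mathbf{OV}\cup\mathbf{PV}\cup\{\top,\bot\}$ into $\mathfrak{H}(\mathbb{K})$ with $v(p)\sqcap v(p)=v(p)$ ($p\in\mathbf{OV}$), $v(P)\sqcup v(P)=v(P)$ ($P\in\mathbf{PV}$), $v(\top)=(G,\emptyset)$, $v(\bot)=(\emptyset,M)$.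 Satisfaction $g\models\alpha$ ($g\in G$) and co-satisfaction $m\succ\alpha$ ($m\in M$) in $\mathbb{M}$: $g\models p$ iff $g\in ext(v(p))$; $g\models P$ iff $g\in ext(v(P))$; $g\models\top$ always; $g\not\models\bot$ always; $m\not\succ\top$ always; $m\succ\bot$ always; $g\models\alpha\sqcap\beta$ iff $g\models\alpha$ and $g\models\beta$; $g\models\neg\alpha$ iff $g\not\models\alpha$; $m\succ p$ iff $m\in int(v(p))$; $m\succ P$ iff $m\in int(v(P))$; $m\succ\alpha\sqcup\beta$ iff $m\succ\alpha$ and $m\succ\beta$; $m\succ\lrcorner\alpha$ iff $m\not\succ\alpha$; $g\models\alpha\sqcup\beta$ iff $\forall m\in M(m\succ\alpha\sqcup\beta\Rightarrow gRm)$; $g\models\lrcorner\alpha$ iff $\forall m(m\not\succ\alpha\Rightarrow gRm)$; $m\succ\neg\alpha$ iff $\forall g(g\not\models\alpha\Rightarrow gRm)$; $m\succ\alpha\sqcap\beta$ iff $\forall g(g\models\alpha\sqcap\beta\Rightarrow gRm)$. A sequent $\alpha\vdash\beta$ is satisfied in $\mathbb{M}$ iff $\forall g(g\models\alpha\Rightarrow g\models\beta)$ and $\forall m(m\succ\beta\Rightarrow m\succ\alpha)$; it is true in $\mathbb{K}$ if satisfied in every model based on $\mathbb{K}$, and valid in a class of contexts if true in each member. -}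

module Defs where

open import Level using (0ℓ)
open import Data.Nat using (ℕ)
open import Data.Product using (Σ; _×_; _,_; proj₁; proj₂)
open import Data.Sum using (_⊎_; inj₁; inj₂)
open import Relation.Nullary using (¬_)
import Data.Unit
import Data.Empty
open import Relation.Unary using (Pred; _≐_; _∩_)

infixr 7 _⊓_
infixr 6 _⊔_
data Fm : Set where
  ov  : ℕ → Fm
  pv  : ℕ → Fm
  ⊤ ⊥ : Fm
  _⊓_ _⊔_ : Fm → Fm → Fm
  ¬ᶠ_ : Fm → Fm
  ⌟_  : Fm → Fm

record Context : Set₁ where
  field
    G : Set
    M : Set
    R : G → M → Set

module _ (K : Context) where
  open Context K

  _′ᴳ : Pred G 0ℓ → Pred M 0ℓ
  (A ′ᴳ) m = ∀ g → A g → R g m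

  _′ᴹ : Pred M 0ℓ → Pred G 0ℓ
  (B ′ᴹ) g = ∀ m → B m → R g m

  Semiconcept : Set₁
  Semiconcept = Σ (Pred G 0ℓ × Pred M 0ℓ)
                  (λ AB → ((proj₁ AB) ′ᴳ ≐ proj₂ AB) ⊎ ((proj₂ AB) ′ᴹ ≐ proj₁ AB))

  ext : Semiconcept → Pred G 0ℓ
  ext x = proj₁ (proj₁ x)

  int : Semiconcept → Pred M 0ℓ
  int x = proj₂ (proj₁ x)

  _⊓ˢ_ : Semiconcept → Semiconcept → Semiconcept
  x ⊓ˢ y = ((ext x ∩ ext y) , ((ext x ∩ ext y) ′ᴳ)) , inj₁ ((λ z → z) , (λ z → z))

  _⊔ˢ_ : Semiconcept → Semiconcept → Semiconcept
  x ⊔ˢ y = (((int x ∩ int y) ′ᴹ) , (int x ∩ int y)) , inj₂ ((λ z → z) , (λ z → z))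

  _≈ˢ_ : Semiconcept → Semiconcept → Set
  x ≈ˢ y = (ext x ≐ ext y) × (int x ≐ int y)

  -- valuations; v(⊤) = (G, ∅) and v(⊥) = (∅, M) are fixed and used
  -- directly in the satisfaction clauses below.
  record Valuation : Set₁ where
    field
      vO : ℕ → Semiconcept
      vP : ℕ → Semiconcept
      vO-idem : ∀ p → (vO p ⊓ˢ vO p) ≈ˢ vO p
      vP-idem : ∀ P → (vP P ⊔ˢ vP P) ≈ˢ vP P

  module Sat (v : Valuation) where
    open Valuation v
    mutual
      _⊨_ : G → Fm → Set
      g ⊨ ov p    = ext (vO p) g
      g ⊨ pv P    = ext (vP P) g
      g ⊨ ⊤       = Data.Unit.⊤
      g ⊨ ⊥       = Data.Empty.⊥
      g ⊨ (α ⊓ β) = (g ⊨ α) × (g ⊨ β)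
      g ⊨ (¬ᶠ α)  = ¬ (g ⊨ α)
      g ⊨ (α ⊔ β) = ∀ m → (m ≻ α) × (m ≻ β) → R g m
      g ⊨ (⌟ α)   = ∀ m → ¬ (m ≻ α) → R g m

      _≻_ : M → Fm → Set
      m ≻ ov p    = int (vO p) m
      m ≻ pv P    = int (vP P) m
      m ≻ ⊤       = Data.Empty.⊥
      m ≻ ⊥       = Data.Unit.⊤
      m ≻ (α ⊔ β) = (m ≻ α) × (m ≻ β)
      m ≻ (⌟ α)   = ¬ (m ≻ α)
      m ≻ (¬ᶠ α)  = ∀ g → ¬ (g ⊨ α) → R g m
      m ≻ (α ⊓ β) = ∀ g → (g ⊨ α) × (g ⊨ β) → R g m

  SatisfiedIn : Valuation → Fm → Fm → Set
  SatisfiedIn v α β = (∀ g → g ⊨ α → g ⊨ β) × (∀ m → m ≻ β → m ≻ α)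
    where open Sat v

  TrueIn : Fm → Fm → Set₁
  TrueIn α β = (v : Valuation) → SatisfiedIn v α β

ContextClass : Set₂
ContextClass = Context → Set₁

ValidIn : ContextClass → Fm → Fm → Set₁
ValidIn 𝒦 α β = (K : Context) → 𝒦 K → TrueIn K α β

-- Whatever the valuation, every object satisfies ⊤ ⊓ ⊤ and every property
-- co-satisfies ⊥ ⊔ ⊥, so ⊥ ⊔ ⊥ ⊢ ⊤ ⊓ ⊤ holds in every context.  An object
-- satisfies ⊥ ⊔ ⊥ iff it is related to every property, so ⊤ ⊓ ⊤ ⊢ ⊥ ⊔ ⊥ holds
-- in a model exactly when R = G × M; valuations always exist, so this is also
-- the condition for truth in the context.
{-# OPTIONS --safe #-}
module Submission where

open import Defs
open import Data.Product using (_×_; _,_; proj₁)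
open import Data.Sum using (inj₁)
open import Data.Unit using (tt)
open import Function.Bundles using (_⇔_; mk⇔; Equivalence)

Full : Context → Set
Full K = ∀ g m → Context.R K g m

module _ (K : Context) where
  open Context K

  topConcept : Semiconcept K
  topConcept = ((λ _ → Data.Unit.⊤) , _′ᴳ K (λ _ → Data.Unit.⊤)) , inj₁ ((λ z → z) , (λ z → z))

  constantValuation : Valuation K
  constantValuation = record
    { vO      = λ _ → topConcept
    ; vP      = λ _ → topConcept
    ; vO-idem = λ _ → (proj₁ , λ x → x , x)
                    , ((λ f g _ → f g (tt , tt)) , (λ f g _ → f g tt))
    ; vP-idem = λ _ → ((λ _ → tt) , (λ {g} _ m p → proj₁ p g tt))
                    , (proj₁ , λ x → x , x)
    }

  module _ (v : Valuation K) where
    open Sat K v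

    ⊨-⊤⊓⊤ : ∀ g → g ⊨ (⊤ ⊓ ⊤)
    ⊨-⊤⊓⊤ _ = tt , tt

    ≻-⊥⊔⊥ : ∀ m → m ≻ (⊥ ⊔ ⊥)
    ≻-⊥⊔⊥ _ = tt , tt

    ⊨-⊥⊔⊥⇔related-to-all : ∀ g → (g ⊨ (⊥ ⊔ ⊥)) ⇔ (∀ m → R g m)
    ⊨-⊥⊔⊥⇔related-to-all g = mk⇔ (λ g⊨ m → g⊨ m (≻-⊥⊔⊥ m)) (λ gR m _ → gR m)

    ≻-⊤⊓⊤⇔related-to-all : ∀ m → (m ≻ (⊤ ⊓ ⊤)) ⇔ (∀ g → R g m)
    ≻-⊤⊓⊤⇔related-to-all m = mk⇔ (λ m≻ g → m≻ g (⊨-⊤⊓⊤ g)) (λ Rm g _ → Rm g)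

  ⊥⊔⊥⊢⊤⊓⊤-true : TrueIn K (⊥ ⊔ ⊥) (⊤ ⊓ ⊤)
  ⊥⊔⊥⊢⊤⊓⊤-true v = (λ g _ → ⊨-⊤⊓⊤ v g) , (λ m _ → ≻-⊥⊔⊥ v m)

  ⊤⊓⊤⊢⊥⊔⊥-true⇔full : TrueIn K (⊤ ⊓ ⊤) (⊥ ⊔ ⊥) ⇔ Full K
  ⊤⊓⊤⊢⊥⊔⊥-true⇔full = mk⇔ to from
    where
    to : TrueIn K (⊤ ⊓ ⊤) (⊥ ⊔ ⊥) → Full K
    to true g = Equivalence.to (⊨-⊥⊔⊥⇔related-to-all constantValuation g)
                  (proj₁ (true constantValuation) g (⊨-⊤⊓⊤ constantValuation g))

    from : Full K → TrueIn K (⊤ ⊓ ⊤) (⊥ ⊔ ⊥)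
    from full v = (λ g _ → Equivalence.from (⊨-⊥⊔⊥⇔related-to-all v g) (full g))
                , (λ m _ → Equivalence.from (≻-⊤⊓⊤⇔related-to-all v m) (λ g → full g m))

theorem68 : (𝒦 : ContextClass) →
    (ValidIn 𝒦 (⊤ ⊓ ⊤) (⊥ ⊔ ⊥) × ValidIn 𝒦 (⊥ ⊔ ⊥) (⊤ ⊓ ⊤)) ⇔
    ((K : Context) → 𝒦 K → ∀ g m → Context.R K g m)
theorem68 𝒦 = mk⇔
  (λ (valid , _) K K∈𝒦 → Equivalence.to (⊤⊓⊤⊢⊥⊔⊥-true⇔full K) (valid K K∈𝒦))
  (λ full → (λ K K∈𝒦 → Equivalence.from (⊤⊓⊤⊢⊥⊔⊥-true⇔full K) (full K K∈𝒦))
          , (λ K _ → ⊥⊔⊥⊢⊤⊓⊤-true K))
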